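{- Let $A = (L, C, \to, \ell_0)$ be a timed automaton with maximal constant $MC$ and let $\ell_g \in L$. The following (nondeterministic) time-dart reachability algorithm terminates, and it returns true if and only if $\ell_g$ is reachable in the discrete semantics $T_{DS}(A)$, for every resolution of its nondeterministic choices. Algorithm: the passed-waiting list is a function $PW : L \times \mathcal{A}(C) \to (\mathbb{N} \times \mathbb{N}_\infty) \cup \{\bot\}$, initially $\bot$ everywhere. Call AddToPW$(\ell_0, \alpha_0, 0, \infty)$, where $\alpha_0(x) = 0$ for all $x$. While there exists $(\ell, \alpha)$ with $PW(\ell,\alpha) = (w,p)$ and $w < p$: pick any such $(\ell,\alpha)$; set $PW(\ell,\alpha) := (w,w)$; then for each edge $(\ell, g, R, \ell') \in \to$ starting in $\ell$: - $start := \max\{w, \max\{\mathrm{lb}(g(x)) - \alpha(x) \mid x \in C\}\}$; - $end := \min\{\mathrm{ub}(g(x)) - \alpha(x) \mid x \in C\}$ (where $\infty - n = \infty$); - if $start < p$ and $start \le end$: - if $R = \emptyset$, call AddToPW$(\ell', (\alpha \oplus_{MC} start) - start, start, \infty)$, where subtracting $start$ from a valuation subtracts it from every clock; - otherwise let $stop := \max\{start, MC + 1 - \min_{x \in C \setminus R} \alpha(x)\}$ (with $\min \emptyset = \infty$, so $stop = start$ when $R = C$), and for $n = start, start+1, \dots, \min\{end, p-1, stop\}$ call AddToPW$(\ell', (\alpha \oplus_{MC} n)[R:=0], 0, \infty)$. When the while-loop ends, return false. Procedure AddToPW$(\ell, \alpha, w, p)$: if $\ell = \ell_g$, return true and terminate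 the whole algorithm. Otherwise, if $PW(\ell,\alpha) = \bot$ set $PW(\ell,\alpha) := (w,p)$; else, with $(w',p') := PW(\ell,\alpha)$, set $PW(\ell,\alpha) := (\min\{w,w'\}, \min\{p,p'\})$.
   Context: $\mathbb{N}$ denotes the nonnegative integers and $\mathbb{N}_\infty = \mathbb{N}\cup\{\infty\}$, with $n<\infty$ and $n+\infty=\infty$. A time interval is $[a,b]$ or $[a,\infty)$ with $a \le b$ in $\mathbb{N}$; $\mathrm{lb}$ and $\mathrm{ub}$ give its lower and upper bound ($b$, resp. $\infty$). A clock guard over a finite clock set $C$ assigns a time interval $g(x)$ to each $x \in C$; a valuation $v : C \to \mathbb{N}$ satisfies $g$ if $v(x) \in g(x)$ for all $x$. A timed automaton is $A = (L, C, \to, \ell_0)$ with $L$ a finite set of locations, $C$ a finite set of clocks, $\to$ a finite set of edges $(\ell,g,R,\ell')$, also written $\ell \xrightarrow{g,R} \ell'$ ($g$ a clock guard, $R \subseteq C$), and initial location $\ell_0$. $MC$ is the largest integer appearing in any guard of $A$. For a valuation $v$: $(v+d)(x)=v(x)+d$; $v[R:=0](x)=0$ for $x\in R$ and $v(x)$ otherwise. Bounded addition: $n \oplus_{MC} m = MC+1$ if $n+m > MC$ and $n+m$ otherwise, applied pointwise to valuations. An anchor point is a valuation $\alpha : C \to \mathbb{N}$ with $\alpha(x) = 0$ for at least one $x \in C$; $\mathcal{A}(C)$ is the set of anchor points. The discrete semantics $T_{DS}(A)$ has states $(\ell,v)$ and transitions $(\ell,v)\xrightarrow{\tau}(\ell',v[R:=0])$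 for each edge $\ell\xrightarrow{g,R}\ell'$ with $v\models g$, and $(\ell,v)\xrightarrow{d}(\ell,v+d)$ for $d\in\mathbb{N}$. A location $\ell_g$ is reachable in $T_{DS}(A)$ if $(\ell_0,v_0)\to^*(\ell_g,v)$ for some $v$, where $v_0 \equiv 0$ and $\to^*$ is the reflexive-transitive closure of the union of all transitions. -}

module Defs where

open import Data.Nat as ℕ using (ℕ; zero; suc; _+_; _∸_; _⊔_; _⊓_; _≤_; _<_)
open import Data.Integer as ℤ using (ℤ; +_)
open import Data.Fin as Fin using (Fin)
open import Data.Fin.Subset using (Subset)
open import Data.Vec as Vec using (Vec; lookup; tabulate; replicate)
import Data.Vec.Properties as VecP
open import Data.List as List using (List; []; _∷_; foldr; allFin; upTo)
open import Data.List.Membership.Propositional using (_∈_)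
open import Data.Maybe using (Maybe; just; nothing)
open import Data.Product using (_×_; _,_; ∃-syntax)
open import Data.Bool using (Bool; true; false; if_then_else_; not; _∧_)
import Data.Bool
open import Relation.Nullary using (¬_; does)
open import Relation.Binary.PropositionalEquality using (_≡_)
open import Relation.Binary.Construct.Closure.ReflexiveTransitive using (Star)

data ℕ∞ : Set where
  fin : ℕ → ℕ∞
  ∞   : ℕ∞

data _<∞_ : ℕ∞ → ℕ∞ → Set where
  fin<fin : ∀ {a b} → a < b → fin a <∞ fin b
  fin<∞   : ∀ {a} → fin a <∞ ∞

data _≤∞_ : ℕ∞ → ℕ∞ → Set where
  fin≤fin : ∀ {a b} → a ≤ b → fin a ≤∞ fin b
  ≤∞-top  : ∀ {x} → x ≤∞ ∞

_<ᵇ∞_ : ℕ∞ → ℕ∞ → Bool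
fin a <ᵇ∞ fin b = a ℕ.<ᵇ b
fin a <ᵇ∞ ∞     = true
∞     <ᵇ∞ _     = false

min∞ : ℕ∞ → ℕ∞ → ℕ∞
min∞ (fin a) (fin b) = fin (a ⊓ b)
min∞ (fin a) ∞       = fin a
min∞ ∞       y       = y

-- ℤ ∪ {∞}, used for the value `end` (which may be negative)
data ℤ∞ : Set where
  int : ℤ → ℤ∞
  ∞ℤ  : ℤ∞

minℤ∞ : ℤ∞ → ℤ∞ → ℤ∞
minℤ∞ (int a) (int b) = int (a ℤ.⊓ b)
minℤ∞ (int a) ∞ℤ      = int a
minℤ∞ ∞ℤ      y       = y

_-∞_ : ℕ∞ → ℕ → ℤ∞
fin b -∞ n = int (+ b ℤ.- + n)
∞     -∞ n = ∞ℤ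

_≤ᵇℤ∞_ : ℕ → ℤ∞ → Bool
n ≤ᵇℤ∞ int z = (+ n) ℤ.≤ᵇ z
n ≤ᵇℤ∞ ∞ℤ    = true

record Interval : Set where
  constructor interval
  field
    lb    : ℕ
    ub    : ℕ∞
    lb≤ub : fin lb ≤∞ ub
open Interval public

Guard : ℕ → Set
Guard k = Fin k → Interval

Valuation : ℕ → Set
Valuation k = Vec ℕ k

_⊨_ : ∀ {k} → Valuation k → Guard k → Set
v ⊨ g = ∀ x → lb (g x) ≤ lookup v x × fin (lookup v x) ≤∞ ub (g x)

zeroVal : ∀ {k} → Valuation k
zeroVal = replicate _ 0

delayBy : ∀ {k} → Valuation k → ℕ → Valuation k
delayBy v d = Vec.map (_+ d) v

resetVal : ∀ {k} → Valuation k → Subset k → Valuation k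
resetVal v R = tabulate (λ x → if lookup R x then 0 else lookup v x)

bAdd : ℕ → ℕ → ℕ → ℕ
bAdd MC a n = if MC ℕ.<ᵇ a + n then suc MC else a + n

_⊕[_]_ : ∀ {k} → Valuation k → ℕ → ℕ → Valuation k
α ⊕[ MC ] n = Vec.map (λ a → bAdd MC a n) α

record Edge (m k : ℕ) : Set where
  constructor edge
  field
    src   : Fin m
    guard : Guard k
    reset : Subset k
    tgt   : Fin m
open Edge public

record TA (m k : ℕ) : Set where
  constructor ta
  field
    edges : List (Edge m k)
    ℓ₀    : Fin m
open TA public

ubVal : ℕ∞ → ℕ
ubVal (fin b) = b
ubVal ∞       = 0

MC : ∀ {m k} → TA m k → ℕ
MC {k = k} A =
  foldr (λ e acc → acc ⊔ foldr (λ x acc' → acc' ⊔ lb (guard e x) ⊔ ubVal (ub (guard e x))) 0 (allFin k))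
        0 (edges A)

State : ℕ → ℕ → Set
State m k = Fin m × Valuation k

data DSStep {m k} (A : TA m k) : State m k → State m k → Set where
  act   : ∀ {e v} → e ∈ edges A → v ⊨ guard e →
          DSStep A (src e , v) (tgt e , resetVal v (reset e))
  delay : ∀ {ℓ v} (d : ℕ) → DSStep A (ℓ , v) (ℓ , delayBy v d)

Reachable : ∀ {m k} → TA m k → Fin m → Set
Reachable {k = k} A ℓg = ∃[ v ] Star (DSStep A) (ℓ₀ A , zeroVal) (ℓg , v)

-- passed-waiting list; nothing = ⊥
PW : ℕ → ℕ → Set
PW m k = Fin m → Valuation k → Maybe (ℕ × ℕ∞)

emptyPW : ∀ {m k} → PW m k
emptyPW _ _ = nothing

updatePW : ∀ {m k} → PW m k → Fin m → Valuation k → Maybe (ℕ × ℕ∞) → PW m k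
updatePW pw ℓ α e ℓ' α' =
  if does (ℓ' Fin.≟ ℓ) ∧ does (VecP.≡-dec ℕ._≟_ α' α) then e else pw ℓ' α'

-- result of a sequence of AddToPW calls: either the algorithm returned
-- true (ℓg hit), or we continue with a new PW
data Outcome (m k : ℕ) : Set where
  hit  : Outcome m k
  cont : PW m k → Outcome m k

_>>=_ : ∀ {m k} → Outcome m k → (PW m k → Outcome m k) → Outcome m k
hit      >>= f = hit
cont pw  >>= f = f pw

foldPW : ∀ {m k} {A : Set} → List A → (A → PW m k → Outcome m k) → PW m k → Outcome m k
foldPW []       f pw = cont pw
foldPW (a ∷ as) f pw = f a pw >>= foldPW as f

range : ℕ → ℕ → List ℕ
range a b = List.map (λ i → a + i) (upTo (suc b ∸ a))

isEmptySubset : ∀ {k} → Subset k → Bool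
isEmptySubset R = Vec.foldr _ (λ b acc → not b ∧ acc) true R

module Algorithm {m k : ℕ} (A : TA m k) (ℓg : Fin m) where

  M : ℕ
  M = MC A

  addToPW : PW m k → Fin m → Valuation k → ℕ → ℕ∞ → Outcome m k
  addToPW pw ℓ α w p =
    if does (ℓ Fin.≟ ℓg) then hit else cont (updatePW pw ℓ α (just (merge (pw ℓ α))))
    where
      merge : Maybe (ℕ × ℕ∞) → ℕ × ℕ∞
      merge nothing           = (w , p)
      merge (just (w' , p'))  = (w ⊓ w' , min∞ p p')

  handleEdge : Valuation k → ℕ → ℕ∞ → Edge m k → PW m k → Outcome m k
  handleEdge α w p e pw =
    if (fin start <ᵇ∞ p) ∧ (start ≤ᵇℤ∞ end)
      then (if isEmptySubset R
              then addToPW pw (tgt e) (Vec.map (_∸ start) (α ⊕[ M ] start)) start ∞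
              else foldPW ns (λ n pw' → addToPW pw' (tgt e) (resetVal (α ⊕[ M ] n) R) 0 ∞) pw)
      else cont pw
    where
      g = guard e
      R = reset e
      -- max{w, max{lb(g x) - α x}}  (negative terms are irrelevant since w ≥ 0)
      start : ℕ
      start = foldr (λ x acc → acc ⊔ (lb (g x) ∸ lookup α x)) w (allFin k)
      end : ℤ∞
      end = foldr (λ x acc → minℤ∞ acc (ub (g x) -∞ lookup α x)) ∞ℤ (allFin k)
      minNotR : ℕ∞
      minNotR = foldr (λ x acc → if lookup R x then acc else min∞ acc (fin (lookup α x))) ∞ (allFin k)
      stop : ℕ
      stop with minNotR
      ... | fin mn = start ⊔ (suc M ∸ mn)
      ... | ∞      = start
      ns : List ℕ
      ns = List.filter (λ n → (n ≤ᵇℤ∞ end) Data.Bool.≟ true) (List.filter (λ n → (fin n <ᵇ∞ p) Data.Bool.≟ true) (range start stop))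

  iteration : PW m k → Fin m → Valuation k → ℕ → ℕ∞ → Outcome m k
  iteration pw ℓ α w p =
    foldPW (List.filter (λ e → src e Fin.≟ ℓ) (edges A)) (handleEdge α w p)
           (updatePW pw ℓ α (just (w , fin w)))

  data Config : Set where
    running  : PW m k → Config
    returned : Bool → Config

  toConfig : Outcome m k → Config
  toConfig hit       = returned true
  toConfig (cont pw) = running pw

  initConfig : Config
  initConfig = toConfig (addToPW emptyPW (ℓ₀ A) zeroVal 0 ∞)

  -- nondeterministic small-step semantics of the while loop
  data AlgStep : Config → Config → Set where
    pick   : ∀ pw ℓ α w p → pw ℓ α ≡ just (w , p) → fin w <∞ p →
             AlgStep (running pw) (toConfig (iteration pw ℓ α w p))
    finish : ∀ pw → (∀ ℓ α w p → pw ℓ α ≡ just (w , p) → ¬ (fin w <∞ p)) →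
             AlgStep (running pw) (returned false)

module Submission where

-- Guards only compare clocks with constants ≤ MC, so a valuation may be replaced by its cap at
-- MC + 1; a dart (ℓ, α, w, p) of the passed-waiting list stands for the capped valuations α ⊕ d,
-- d ≥ w, of which those with d < p are still waiting. The algorithm maintains three facts: every
-- represented valuation is the cap of a reachable one (so reaching ℓg is sound), the initial state
-- is represented, and every passed delay has all its edge successors represented. When nothing is
-- waiting the represented set is closed under the discrete semantics, so it contains every
-- reachable state and, holding no dart at ℓg, shows ℓg unreachable. For termination, anchors stay
-- in {0, …, MC + 1}^C and finite pass values stay ≤ MC, so the sum over all bounded anchors of the
-- pass value (MC + 1 for ∞, MC + 2 for ⊥) is a natural number that each iteration decreases.

open import Defs
open import Data.Nat as ℕ using (ℕ; zero; suc; _+_; _∸_; _⊔_; _⊓_; _≤_; _<_; _<ᵇ_; z≤n; s≤s)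
open import Data.Nat.Properties
import Data.Integer as ℤ
import Data.Integer.Properties as ℤP
open import Data.Fin as Fin using (Fin)
open import Data.Fin.Subset using (Subset)
open import Data.Vec as Vec using (Vec; []; _∷_; lookup)
import Data.Vec.Properties as VecP
open import Data.List as List using (List; []; _∷_; foldr; allFin; upTo)
open import Data.Nat.ListAction using (sum)
open import Data.List.Membership.Propositional using (_∈_)
open import Data.List.Membership.Propositional.Properties
open import Data.List.Relation.Unary.All as All using (All; []; _∷_)
open import Data.List.Relation.Unary.Any using (here; there)
open import Data.Maybe using (Maybe; just; nothing)
open import Data.Product using (_×_; _,_; ∃-syntax; proj₁; proj₂; uncurry)
open import Data.Sum using (_⊎_; inj₁; inj₂; [_,_]′)
open import Data.Bool as Bool using (true; false; if_then_else_; T)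
open import Data.Bool.Properties using (T-≡)
open import Data.Unit using (⊤; tt)
open import Data.Empty using (⊥-elim)
open import Function using (_∘_)
open import Function.Bundles using (_⇔_; mk⇔; Equivalence)
open import Relation.Nullary using (¬_; Dec; yes; no; contradiction)
open import Relation.Nullary.Decidable using (dec-true)
open import Relation.Binary.PropositionalEquality
open import Relation.Binary.Construct.Closure.ReflexiveTransitive using (Star; ε; _◅_; _◅◅_)
open import Induction.WellFounded using (Acc; acc)

open Equivalence using (to; from)

≤-<∞-trans : ∀ {a b p} → a ≤ b → fin b <∞ p → fin a <∞ p
≤-<∞-trans a≤b (fin<fin b<c) = fin<fin (≤-<-trans a≤b b<c)
≤-<∞-trans a≤b fin<∞ = fin<∞

≤-≤∞-trans : ∀ {a b u} → a ≤ b → fin b ≤∞ u → fin a ≤∞ u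
≤-≤∞-trans a≤b (fin≤fin b≤c) = fin≤fin (≤-trans a≤b b≤c)
≤-≤∞-trans a≤b ≤∞-top = ≤∞-top

<∞⇒<ᵇ∞ : ∀ {a p} → fin a <∞ p → fin a <ᵇ∞ p ≡ true
<∞⇒<ᵇ∞ (fin<fin a<b) = to T-≡ (<⇒<ᵇ a<b)
<∞⇒<ᵇ∞ fin<∞ = refl

≮∞⇒≡fin : ∀ {w} p → ¬ fin w <∞ p → ∃[ q ] (p ≡ fin q × q ≤ w)
≮∞⇒≡fin (fin q) w≮q = q , refl , ≮⇒≥ (w≮q ∘ fin<fin)
≮∞⇒≡fin ∞ w≮∞ = contradiction fin<∞ w≮∞

+≤+-∸+⇔ : ∀ n a b → (ℤ.+ n ℤ.≤ ℤ.+ b ℤ.- ℤ.+ a) ⇔ (a + n ≤ b)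
+≤+-∸+⇔ n a b = mk⇔ to′ from′
  where
    +b-+a≡ : a ≤ b → ℤ.+ b ℤ.- ℤ.+ a ≡ ℤ.+ (b ∸ a)
    +b-+a≡ a≤b = trans (ℤP.m-n≡m⊖n b a) (ℤP.⊖-≥ a≤b)

    to′ : ℤ.+ n ℤ.≤ ℤ.+ b ℤ.- ℤ.+ a → a + n ≤ b
    to′ n≤b-a = subst (_≤ b) (+-comm n a)
      (m≤o∸n⇒m+n≤o n a≤b (ℤP.drop‿+≤+ (subst (ℤ.+ n ℤ.≤_) (+b-+a≡ a≤b) n≤b-a)))
      where
        a≤b : a ≤ b
        a≤b = ℤP.drop‿+≤+ (ℤP.0≤i-j⇒j≤i (ℤP.≤-trans (ℤ.+≤+ z≤n) n≤b-a))

    from′ : a + n ≤ b → ℤ.+ n ℤ.≤ ℤ.+ b ℤ.- ℤ.+ a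
    from′ a+n≤b = subst (ℤ.+ n ℤ.≤_) (sym (+b-+a≡ (m+n≤o⇒m≤o a a+n≤b)))
      (ℤ.+≤+ (m+n≤o⇒m≤o∸n n (subst (_≤ b) (+-comm a n) a+n≤b)))

ℤ≤ᵇ⇔≤ : ∀ i j → ((i ℤ.≤ᵇ j) ≡ true) ⇔ (i ℤ.≤ j)
ℤ≤ᵇ⇔≤ i j = mk⇔ (ℤP.≤ᵇ⇒≤ ∘ from T-≡) (to T-≡ ∘ ℤP.≤⇒≤ᵇ)

≤ᵇℤ∞-∞⇔ : ∀ n a u → (n ≤ᵇℤ∞ (u -∞ a) ≡ true) ⇔ (fin (a + n) ≤∞ u)
≤ᵇℤ∞-∞⇔ n a (fin b) = mk⇔
  (λ le → fin≤fin (to (+≤+-∸+⇔ n a b) (to (ℤ≤ᵇ⇔≤ (ℤ.+ n) _) le)))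
  (λ { (fin≤fin le) → from (ℤ≤ᵇ⇔≤ (ℤ.+ n) _) (from (+≤+-∸+⇔ n a b) le) })
≤ᵇℤ∞-∞⇔ n a ∞ = mk⇔ (λ _ → ≤∞-top) (λ _ → refl)

≤ᵇℤ∞-minℤ∞⇔ : ∀ n a b → (n ≤ᵇℤ∞ minℤ∞ a b ≡ true) ⇔ (n ≤ᵇℤ∞ a ≡ true × n ≤ᵇℤ∞ b ≡ true)
≤ᵇℤ∞-minℤ∞⇔ n (int i) (int j) = mk⇔
  (λ le → let n≤i⊓j = to (ℤ≤ᵇ⇔≤ (ℤ.+ n) (i ℤ.⊓ j)) le in
      from (ℤ≤ᵇ⇔≤ (ℤ.+ n) i) (ℤP.i≤j⊓k⇒i≤j i j n≤i⊓j)
    , from (ℤ≤ᵇ⇔≤ (ℤ.+ n) j) (ℤP.i≤j⊓k⇒i≤k i j n≤i⊓j))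
  (λ (le₁ , le₂) → from (ℤ≤ᵇ⇔≤ (ℤ.+ n) (i ℤ.⊓ j))
     (ℤP.⊓-glb (to (ℤ≤ᵇ⇔≤ (ℤ.+ n) i) le₁) (to (ℤ≤ᵇ⇔≤ (ℤ.+ n) j) le₂)))
≤ᵇℤ∞-minℤ∞⇔ n (int i) ∞ℤ = mk⇔ (λ le → le , refl) proj₁
≤ᵇℤ∞-minℤ∞⇔ n ∞ℤ b = mk⇔ (λ le → refl , le) proj₂

module _ {A : Set} (h : ℕ → A → ℕ) (h-inflationary : ∀ acc x → acc ≤ h acc x) where

  ≤-foldr-init : ∀ b xs → b ≤ foldr (λ x acc → h acc x) b xs
  ≤-foldr-init b [] = ≤-refl
  ≤-foldr-init b (x ∷ xs) = ≤-trans (≤-foldr-init b xs) (h-inflationary _ x)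

  ≤-foldr-elem : (f : A → ℕ) → (∀ acc x → f x ≤ h acc x) →
                 ∀ b {x} xs → x ∈ xs → f x ≤ foldr (λ x acc → h acc x) b xs
  ≤-foldr-elem f f≤h b (x ∷ xs) (here refl) = f≤h _ x
  ≤-foldr-elem f f≤h b (y ∷ xs) (there x∈xs) =
    ≤-trans (≤-foldr-elem f f≤h b xs x∈xs) (h-inflationary _ y)

foldr-⊔-lub : ∀ {A : Set} (f : A → ℕ) {b c} xs → b ≤ c → (∀ x → f x ≤ c) →
              foldr (λ x acc → acc ⊔ f x) b xs ≤ c
foldr-⊔-lub f [] b≤c f≤c = b≤c
foldr-⊔-lub f (x ∷ xs) b≤c f≤c = ⊔-lub (foldr-⊔-lub f xs b≤c f≤c) (f≤c x)

∈-range⁺ : ∀ {s S n} → s ≤ n → n ≤ S → n ∈ range s S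
∈-range⁺ {s} {S} s≤n n≤S =
  subst (_∈ range s S) (m+[n∸m]≡n s≤n) (∈-map⁺ (s +_) (∈-upTo⁺ (∸-monoˡ-< (s≤s n≤S) s≤n)))

∈-range⁻ : ∀ {s S n} → n ∈ range s S → s ≤ n
∈-range⁻ {s} n∈ with ∈-map⁻ (s +_) n∈
... | i , _ , refl = m≤m+n s i

sum-map-mono : ∀ {A : Set} {f g : A → ℕ} → (∀ x → f x ≤ g x) →
               ∀ xs → sum (List.map f xs) ≤ sum (List.map g xs)
sum-map-mono f≤g [] = ≤-refl
sum-map-mono f≤g (x ∷ xs) = +-mono-≤ (f≤g x) (sum-map-mono f≤g xs)

sum-map-mono-< : ∀ {A : Set} {f g : A → ℕ} → (∀ x → f x ≤ g x) →
                 ∀ {x} xs → x ∈ xs → f x < g x → sum (List.map f xs) < sum (List.map g xs)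
sum-map-mono-< f≤g (x ∷ xs) (here refl) fx<gx = +-mono-<-≤ fx<gx (sum-map-mono f≤g xs)
sum-map-mono-< f≤g (y ∷ xs) (there x∈xs) fx<gx = +-mono-≤-< (f≤g y) (sum-map-mono-< f≤g xs x∈xs fx<gx)

vecsBelow : ℕ → (j : ℕ) → List (Vec ℕ j)
vecsBelow B zero = [] ∷ []
vecsBelow B (suc j) = List.cartesianProductWith _∷_ (upTo B) (vecsBelow B j)

∈-vecsBelow : ∀ {B j} (v : Vec ℕ j) → (∀ x → lookup v x < B) → v ∈ vecsBelow B j
∈-vecsBelow [] _ = here refl
∈-vecsBelow (a ∷ v) v<B =
  ∈-cartesianProductWith⁺ _∷_ (∈-upTo⁺ (v<B Fin.zero)) (∈-vecsBelow v (v<B ∘ Fin.suc))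

≗-lookup⇒≡ : ∀ {A : Set} {n} {u v : Vec A n} → (∀ x → lookup u x ≡ lookup v x) → u ≡ v
≗-lookup⇒≡ {u = u} {v} u≗v =
  trans (sym (VecP.tabulate∘lookup u)) (trans (VecP.tabulate-cong u≗v) (VecP.tabulate∘lookup v))

lookup-reset : ∀ {k} (v : Valuation k) R x → lookup (resetVal v R) x ≡ (if lookup R x then 0 else lookup v x)
lookup-reset v R x = VecP.lookup∘tabulate _ x

isEmptySubset⇒∉ : ∀ {k} (R : Subset k) → isEmptySubset R ≡ true → ∀ x → lookup R x ≡ false
isEmptySubset⇒∉ (false ∷ R) R∅ Fin.zero = refl
isEmptySubset⇒∉ (false ∷ R) R∅ (Fin.suc x) = isEmptySubset⇒∉ R R∅ x

resetVal-∅ : ∀ {k} (v : Valuation k) R → isEmptySubset R ≡ true → resetVal v R ≡ v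
resetVal-∅ v R R∅ = trans (VecP.tabulate-cong λ x → cong (if_then 0 else lookup v x) (isEmptySubset⇒∉ R R∅ x))
                          (VecP.tabulate∘lookup v)

infix 4 _∈ᴵ_
_∈ᴵ_ : ℕ → Interval → Set
a ∈ᴵ I = lb I ≤ a × fin a ≤∞ ub I

startOf : ∀ {k} → Valuation k → ℕ → Guard k → ℕ
startOf {k} α w g = foldr (λ x acc → acc ⊔ (lb (g x) ∸ lookup α x)) w (allFin k)

endOf : ∀ {k} → Valuation k → Guard k → ℤ∞
endOf {k} α g = foldr (λ x acc → minℤ∞ acc (ub (g x) -∞ lookup α x)) ∞ℤ (allFin k)

minFree : ∀ {k} → Valuation k → Subset k → ℕ∞
minFree {k} α R = foldr (λ x acc → if lookup R x then acc else min∞ acc (fin (lookup α x))) ∞ (allFin k)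

module _ {k} (α : Valuation k) (w : ℕ) (g : Guard k) where

  w≤startOf : w ≤ startOf α w g
  w≤startOf = ≤-foldr-init _ (λ acc _ → m≤m⊔n acc _) w (allFin k)

  lb≤startOf : ∀ x → lb (g x) ≤ lookup α x + startOf α w g
  lb≤startOf x = ≤-trans (m≤n+m∸n (lb (g x)) (lookup α x)) (+-monoʳ-≤ (lookup α x)
    (≤-foldr-elem _ (λ acc _ → m≤m⊔n acc _) (λ x → lb (g x) ∸ lookup α x) (λ acc _ → m≤n⊔m acc _)
                  w (allFin k) (∈-allFin x)))

  startOf-least : ∀ {d} → w ≤ d → (∀ x → lb (g x) ≤ lookup α x + d) → startOf α w g ≤ d
  startOf-least w≤d lb≤ =
    foldr-⊔-lub (λ x → lb (g x) ∸ lookup α x) (allFin k) w≤d (λ x → m≤n+o⇒m∸n≤o _ (lookup α x) (lb≤ x))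

module _ {k} (α : Valuation k) (g : Guard k) (n : ℕ) where

  private
    Fits : Fin k → Set
    Fits x = fin (lookup α x + n) ≤∞ ub (g x)

    endFrom : List (Fin k) → ℤ∞
    endFrom = foldr (λ x acc → minℤ∞ acc (ub (g x) -∞ lookup α x)) ∞ℤ

    ≤ᵇendFrom⇒ : ∀ xs → n ≤ᵇℤ∞ endFrom xs ≡ true → All Fits xs
    ≤ᵇendFrom⇒ [] _ = []
    ≤ᵇendFrom⇒ (x ∷ xs) le with to (≤ᵇℤ∞-minℤ∞⇔ n (endFrom xs) _) le
    ... | le-xs , le-x = to (≤ᵇℤ∞-∞⇔ n _ (ub (g x))) le-x ∷ ≤ᵇendFrom⇒ xs le-xs

    ≤ᵇendFrom⇐ : ∀ xs → All Fits xs → n ≤ᵇℤ∞ endFrom xs ≡ true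
    ≤ᵇendFrom⇐ [] [] = refl
    ≤ᵇendFrom⇐ (x ∷ xs) (fits ∷ all) =
      from (≤ᵇℤ∞-minℤ∞⇔ n (endFrom xs) _) (≤ᵇendFrom⇐ xs all , from (≤ᵇℤ∞-∞⇔ n _ (ub (g x))) fits)

  ≤ᵇendOf⇒ : n ≤ᵇℤ∞ endOf α g ≡ true → ∀ x → fin (lookup α x + n) ≤∞ ub (g x)
  ≤ᵇendOf⇒ le x = All.lookup (≤ᵇendFrom⇒ (allFin k) le) (∈-allFin x)

  ≤ᵇendOf⇐ : (∀ x → fin (lookup α x + n) ≤∞ ub (g x)) → n ≤ᵇℤ∞ endOf α g ≡ true
  ≤ᵇendOf⇐ fits = ≤ᵇendFrom⇐ (allFin k) (All.tabulate λ {x} _ → fits x)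

min∞-fin-≤ : ∀ t a → ∃[ mn ] (min∞ t (fin a) ≡ fin mn × mn ≤ a)
min∞-fin-≤ (fin b) a = b ⊓ a , refl , m⊓n≤n b a
min∞-fin-≤ ∞ a = a , refl , ≤-refl

minFree-≤ : ∀ {k} (α : Valuation k) R {x} → lookup R x ≡ false → ∃[ mn ] (minFree α R ≡ fin mn × mn ≤ lookup α x)
minFree-≤ {k} α R {x} x∉R = go (allFin k) (∈-allFin x)
  where
    go : ∀ xs → x ∈ xs →
         ∃[ mn ] (foldr (λ x acc → if lookup R x then acc else min∞ acc (fin (lookup α x))) ∞ xs ≡ fin mn
                  × mn ≤ lookup α x)
    go (x ∷ xs) (here refl) rewrite x∉R = min∞-fin-≤ _ (lookup α x)
    go (y ∷ xs) (there x∈xs) with lookup R y | go xs x∈xs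
    ... | true | below = below
    ... | false | mn , eq , mn≤ rewrite eq = mn ⊓ lookup α y , refl , ≤-trans (m⊓n≤m mn _) mn≤

map∘map-cong : ∀ {A : Set} {n} {f g h i : A → A} → (∀ a → f (g a) ≡ h (i a)) →
               (v : Vec A n) → Vec.map f (Vec.map g v) ≡ Vec.map h (Vec.map i v)
map∘map-cong fg≗hi v = trans (sym (VecP.map-∘ _ _ v)) (trans (VecP.map-cong fg≗hi v) (VecP.map-∘ _ _ v))

-- Clock values above M are indistinguishable by guards with constants ≤ M, so
-- bounded addition caps them at M + 1.
module Capping (M : ℕ) where

  cap : ℕ → ℕ
  cap a = if M <ᵇ a then suc M else a

  data CapView (a : ℕ) : Set where
    above : M < a → cap a ≡ suc M → CapView a
    below : a ≤ M → cap a ≡ a → CapView a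

  capView : ∀ a → CapView a
  capView a with M <ᵇ a in eq
  ... | true = above (<ᵇ⇒< M a (from T-≡ eq)) (cong (if_then suc M else a) eq)
  ... | false = below (≮⇒≥ λ M<a → subst T eq (<⇒<ᵇ M<a)) (cong (if_then suc M else a) eq)

  cap-above : ∀ {a} → M < a → cap a ≡ suc M
  cap-above {a} M<a with capView a
  ... | above _ eq = eq
  ... | below a≤M _ = contradiction a≤M (<⇒≱ M<a)

  cap-≤-suc : ∀ a → cap a ≤ suc M
  cap-≤-suc a with capView a
  ... | above _ eq = ≤-reflexive eq
  ... | below a≤M eq = ≤-trans (≤-reflexive eq) (m≤n⇒m≤1+n a≤M)

  cap-≤ : ∀ a → cap a ≤ a
  cap-≤ a with capView a
  ... | above M<a eq = ≤-trans (≤-reflexive eq) M<a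
  ... | below _ eq = ≤-reflexive eq

  ≤-cap : ∀ {l a} → l ≤ M → l ≤ a → l ≤ cap a
  ≤-cap {a = a} l≤M l≤a with capView a
  ... | above _ eq = ≤-trans (m≤n⇒m≤1+n l≤M) (≤-reflexive (sym eq))
  ... | below _ eq = ≤-trans l≤a (≤-reflexive (sym eq))

  cap-fixed : ∀ {a} → a ≤ suc M → cap a ≡ a
  cap-fixed {a} a≤1+M with capView a
  ... | above M<a eq = trans eq (≤-antisym M<a a≤1+M)
  ... | below _ eq = eq

  cap≤⇒cap≡ : ∀ {a b} → b ≤ M → cap a ≤ b → cap a ≡ a
  cap≤⇒cap≡ {a} b≤M cap≤b with capView a
  ... | above _ eq = contradiction (≤-trans (≤-reflexive (sym eq)) cap≤b) (<⇒≱ (s≤s b≤M))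
  ... | below _ eq = eq

  cap-+ : ∀ a e → cap (cap a + e) ≡ cap (a + e)
  cap-+ a e with capView a
  ... | above M<a eq = begin
    cap (cap a + e)   ≡⟨ cong (λ c → cap (c + e)) eq ⟩
    cap (suc M + e)   ≡⟨ cap-above (m≤n⇒m≤n+o e ≤-refl) ⟩
    suc M             ≡⟨ cap-above (≤-trans M<a (m≤m+n a e)) ⟨
    cap (a + e)       ∎
    where open ≡-Reasoning
  ... | below _ eq = cong (λ c → cap (c + e)) eq

  cap-∸-+ : ∀ a {s d} → s ≤ d → cap (cap (a + s) ∸ s + d) ≡ cap (a + d)
  cap-∸-+ a {s} {d} s≤d with capView (a + s)
  ... | above M<a+s eq = begin
    cap (cap (a + s) ∸ s + d) ≡⟨ cong (λ c → cap (c ∸ s + d)) eq ⟩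
    cap (suc M ∸ s + d)       ≡⟨ cap-above M<1+M∸s+d ⟩
    suc M                     ≡⟨ cap-above (≤-trans M<a+s (+-monoʳ-≤ a s≤d)) ⟨
    cap (a + d)               ∎
    where
      open ≡-Reasoning
      M<1+M∸s+d : M < suc M ∸ s + d
      M<1+M∸s+d = ≤-trans (m≤n+m∸n (suc M) s)
                          (≤-trans (≤-reflexive (+-comm s _)) (+-monoʳ-≤ (suc M ∸ s) s≤d))
  ... | below _ eq = trans (cong (λ c → cap (c ∸ s + d)) eq) (cong (λ c → cap (c + d)) (m+n∸n≡m a s))

  capV : ∀ {k} → Valuation k → Valuation k
  capV = Vec.map cap

  Bounded : ∀ {k} → Valuation k → Set
  Bounded α = ∀ x → lookup α x ≤ suc M

  rebase : ∀ {k} → Valuation k → ℕ → Valuation k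
  rebase α s = Vec.map (_∸ s) (α ⊕[ M ] s)

  lookup-⊕ : ∀ {k} (α : Valuation k) n x → lookup (α ⊕[ M ] n) x ≡ cap (lookup α x + n)
  lookup-⊕ α n x = VecP.lookup-map x _ α

  capV-delay : ∀ {k} (v : Valuation k) d → capV (delayBy v d) ≡ capV v ⊕[ M ] d
  capV-delay v d = map∘map-cong (λ a → sym (cap-+ a d)) v

  capV-reset : ∀ {k} (v : Valuation k) R → capV (resetVal v R) ≡ resetVal (capV v) R
  capV-reset v R = trans (sym (VecP.tabulate-∘ cap _)) (VecP.tabulate-cong λ x → cap-if x (lookup R x))
    where
      cap-if : ∀ x b → cap (if b then 0 else lookup v x) ≡ (if b then 0 else lookup (capV v) x)
      cap-if x true = refl
      cap-if x false = sym (VecP.lookup-map x cap v)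

  capV-zero : ∀ {k} → capV (zeroVal {k}) ≡ zeroVal
  capV-zero {k} = VecP.map-replicate cap 0 k

  ⊕-+ : ∀ {k} (α : Valuation k) d e → (α ⊕[ M ] d) ⊕[ M ] e ≡ α ⊕[ M ] (d + e)
  ⊕-+ α d e = trans (sym (VecP.map-∘ _ _ α))
                    (VecP.map-cong (λ a → trans (cap-+ (a + d) e) (cong cap (+-assoc a d e))) α)

  ⊕-zero : ∀ {k} {u : Valuation k} → Bounded u → u ⊕[ M ] 0 ≡ u
  ⊕-zero {u = u} u-bounded = ≗-lookup⇒≡ λ x →
    trans (lookup-⊕ u 0 x) (trans (cong cap (+-identityʳ (lookup u x))) (cap-fixed (u-bounded x)))

  rebase-⊕ : ∀ {k} (α : Valuation k) {s d} → s ≤ d → rebase α s ⊕[ M ] d ≡ α ⊕[ M ] d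
  rebase-⊕ α s≤d = trans (sym (VecP.map-∘ _ _ _))
                         (trans (sym (VecP.map-∘ _ _ α)) (VecP.map-cong (λ a → cap-∸-+ a s≤d) α))

  ⊕-bounded : ∀ {k} (α : Valuation k) n → Bounded (α ⊕[ M ] n)
  ⊕-bounded α n x = ≤-trans (≤-reflexive (lookup-⊕ α n x)) (cap-≤-suc (lookup α x + n))

  rebase-bounded : ∀ {k} (α : Valuation k) s → Bounded (rebase α s)
  rebase-bounded α s x =
    ≤-trans (≤-reflexive (VecP.lookup-map x (_∸ s) (α ⊕[ M ] s)))
            (≤-trans (m∸n≤m (lookup (α ⊕[ M ] s) x) s) (⊕-bounded α s x))

  reset-bounded : ∀ {k} (u : Valuation k) R → Bounded u → Bounded (resetVal u R)
  reset-bounded u R u-bounded x with lookup R x | lookup-reset u R x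
  ... | true | eq = ≤-trans (≤-reflexive eq) z≤n
  ... | false | eq = ≤-trans (≤-reflexive eq) (u-bounded x)

  zero-bounded : ∀ {k} → Bounded (zeroVal {k})
  zero-bounded x = ≤-trans (≤-reflexive (VecP.lookup-replicate x 0)) z≤n

  Saturated : ∀ {k} → Valuation k → Subset k → ℕ → Set
  Saturated α R S = ∀ x → lookup R x ≡ false → M < lookup α x + S

  reset-stable : ∀ {k} (α : Valuation k) R {s n} → s ≤ n → Saturated α R s →
                 resetVal (α ⊕[ M ] n) R ≡ resetVal (α ⊕[ M ] s) R
  reset-stable α R {s} {n} s≤n saturated = VecP.tabulate-cong λ x → same x (lookup R x) refl
    where
      same : ∀ x b → lookup R x ≡ b →
             (if b then 0 else lookup (α ⊕[ M ] n) x) ≡ (if b then 0 else lookup (α ⊕[ M ] s) x)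
      same x true _ = refl
      same x false x∉R = begin
        lookup (α ⊕[ M ] n) x   ≡⟨ lookup-⊕ α n x ⟩
        cap (lookup α x + n)    ≡⟨ cap-above (≤-trans (saturated x x∉R) (+-monoʳ-≤ (lookup α x) s≤n)) ⟩
        suc M                   ≡⟨ cap-above (saturated x x∉R) ⟨
        cap (lookup α x + s)    ≡⟨ lookup-⊕ α s x ⟨
        lookup (α ⊕[ M ] s) x   ∎
        where open ≡-Reasoning

  saturated-fin : ∀ {k} (α : Valuation k) R {mn} → minFree α R ≡ fin mn → ∀ s → Saturated α R (s ⊔ (suc M ∸ mn))
  saturated-fin α R {mn} min≡ s x x∉R with minFree-≤ α R x∉R
  ... | mn′ , min≡′ , mn′≤ with trans (sym min≡) min≡′
  ... | refl = ≤-trans (m≤n+m∸n (suc M) mn) (+-mono-≤ mn′≤ (m≤n⊔m s _))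

  saturated-∞ : ∀ {k} (α : Valuation k) R → minFree α R ≡ ∞ → ∀ S → Saturated α R S
  saturated-∞ α R min≡ S x x∉R with minFree-≤ α R x∉R
  ... | _ , min≡′ , _ = contradiction (trans (sym min≡) min≡′) λ ()

  Small : Interval → Set
  Small I = lb I ≤ M × ubVal (ub I) ≤ M

  SmallGuard : ∀ {k} → Guard k → Set
  SmallGuard g = ∀ x → Small (g x)

  cap-∈ᴵ : ∀ {I} a → Small I → a ∈ᴵ I → cap a ∈ᴵ I
  cap-∈ᴵ {interval l (fin b) _} a (l≤M , _) (l≤a , fin≤fin a≤b) = ≤-cap l≤M l≤a , fin≤fin (≤-trans (cap-≤ a) a≤b)
  cap-∈ᴵ {interval l ∞ _} a (l≤M , _) (l≤a , _) = ≤-cap l≤M l≤a , ≤∞-top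

  uncap-∈ᴵ : ∀ {I} a → Small I → cap a ∈ᴵ I → a ∈ᴵ I
  uncap-∈ᴵ {interval l (fin b) _} a (_ , b≤M) (l≤cap , fin≤fin cap≤b) =
    ≤-trans l≤cap (cap-≤ a) , fin≤fin (subst (_≤ b) (cap≤⇒cap≡ b≤M cap≤b) cap≤b)
  uncap-∈ᴵ {interval l ∞ _} a _ (l≤cap , _) = ≤-trans l≤cap (cap-≤ a) , ≤∞-top

  module Guarded {k} {g : Guard k} (small : SmallGuard g) where

    ⊨-capV⁺ : ∀ {v} → v ⊨ g → capV v ⊨ g
    ⊨-capV⁺ {v} sat x = subst (_∈ᴵ g x) (sym (VecP.lookup-map x cap v)) (cap-∈ᴵ {g x} (lookup v x) (small x) (sat x))

    ⊨-capV⁻ : ∀ {v} → capV v ⊨ g → v ⊨ g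
    ⊨-capV⁻ {v} sat x = uncap-∈ᴵ {g x} (lookup v x) (small x) (subst (_∈ᴵ g x) (VecP.lookup-map x cap v) (sat x))

    ⊨-⊕⁻ : ∀ α d → (α ⊕[ M ] d) ⊨ g → ∀ x → lookup α x + d ∈ᴵ g x
    ⊨-⊕⁻ α d sat x = uncap-∈ᴵ {g x} (lookup α x + d) (small x) (subst (_∈ᴵ g x) (lookup-⊕ α d x) (sat x))

    ⊨-⊕⁺ : ∀ α d → (∀ x → lookup α x + d ∈ᴵ g x) → (α ⊕[ M ] d) ⊨ g
    ⊨-⊕⁺ α d fits x = subst (_∈ᴵ g x) (sym (lookup-⊕ α d x)) (cap-∈ᴵ {g x} (lookup α x + d) (small x) (fits x))

    startOf-≤ : ∀ α w → w ≤ M → startOf α w g ≤ M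
    startOf-≤ α w w≤M = startOf-least α w g w≤M (λ x → ≤-trans (proj₁ (small x)) (m≤n+m M (lookup α x)))

    ⊨⇒startOf≤ : ∀ α w d → w ≤ d → (α ⊕[ M ] d) ⊨ g → startOf α w g ≤ d
    ⊨⇒startOf≤ α w d w≤d sat = startOf-least α w g w≤d (λ x → proj₁ (⊨-⊕⁻ α d sat x))

    ⊨⇒≤ᵇendOf : ∀ α n d → n ≤ d → (α ⊕[ M ] d) ⊨ g → n ≤ᵇℤ∞ endOf α g ≡ true
    ⊨⇒≤ᵇendOf α n d n≤d sat =
      ≤ᵇendOf⇐ α g n λ x → ≤-≤∞-trans (+-monoʳ-≤ (lookup α x) n≤d) (proj₂ (⊨-⊕⁻ α d sat x))

    window⇒⊨ : ∀ α w n → startOf α w g ≤ n → n ≤ᵇℤ∞ endOf α g ≡ true → (α ⊕[ M ] n) ⊨ g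
    window⇒⊨ α w n start≤n n≤end = ⊨-⊕⁺ α n λ x →
      ≤-trans (lb≤startOf α w g x) (+-monoʳ-≤ (lookup α x) start≤n) , ≤ᵇendOf⇒ α g n n≤end x

MC-small : ∀ {m k} (A : TA m k) {e} → e ∈ edges A → Capping.SmallGuard (MC A) (guard e)
MC-small {m} {k} A {e} e∈A x = ≤-trans lb≤G G≤MC , ≤-trans ub≤G G≤MC
  where
    h : Edge m k → ℕ → Fin k → ℕ
    h e r x = r ⊔ lb (guard e x) ⊔ ubVal (ub (guard e x))

    h-inflationary : ∀ e r x → r ≤ h e r x
    h-inflationary e r x = ≤-trans (m≤m⊔n r _) (m≤m⊔n _ _)

    G : Edge m k → ℕ
    G e = foldr (λ x acc → h e acc x) 0 (allFin k)

    G≤MC : G e ≤ MC A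
    G≤MC = ≤-foldr-elem (λ r e → r ⊔ G e) (λ r _ → m≤m⊔n r _) G (λ r _ → m≤n⊔m r _) 0 (edges A) e∈A

    lb≤G : lb (guard e x) ≤ G e
    lb≤G = ≤-foldr-elem (h e) (h-inflationary e) (λ x → lb (guard e x))
             (λ acc _ → ≤-trans (m≤n⊔m acc _) (m≤m⊔n _ _)) 0 (allFin k) (∈-allFin x)

    ub≤G : ubVal (ub (guard e x)) ≤ G e
    ub≤G = ≤-foldr-elem (h e) (h-inflationary e) (λ x → ubVal (ub (guard e x)))
             (λ acc _ → m≤n⊔m _ _) 0 (allFin k) (∈-allFin x)

_<∞?_ : ∀ a p → Dec (fin a <∞ p)
a <∞? fin b with a <? b
... | yes a<b = yes (fin<fin a<b)
... | no a≮b = no λ { (fin<fin a<b) → a≮b a<b }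
a <∞? ∞ = yes fin<∞

updatePW-same : ∀ {m k} (pw : PW m k) ℓ α e → updatePW pw ℓ α e ℓ α ≡ e
updatePW-same pw ℓ α e rewrite dec-true (ℓ Fin.≟ ℓ) refl | dec-true (VecP.≡-dec ℕ._≟_ α α) refl = refl

updatePW-cases : ∀ {m k} (pw : PW m k) ℓ α e ℓ′ α′ →
                 (ℓ′ ≡ ℓ × α′ ≡ α × updatePW pw ℓ α e ℓ′ α′ ≡ e) ⊎ (updatePW pw ℓ α e ℓ′ α′ ≡ pw ℓ′ α′)
updatePW-cases pw ℓ α e ℓ′ α′ with ℓ′ Fin.≟ ℓ | VecP.≡-dec ℕ._≟_ α′ α
... | yes refl | yes refl = inj₁ (refl , refl , refl)
... | yes _ | no _ = inj₂ refl
... | no _ | _ = inj₂ refl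

AllEntries : ∀ {m k} → (Fin m → Valuation k → ℕ → ℕ∞ → Set) → PW m k → Set
AllEntries P pw = ∀ {ℓ α w p} → pw ℓ α ≡ just (w , p) → P ℓ α w p

updatePW-AllEntries : ∀ {m k} {P : Fin m → Valuation k → ℕ → ℕ∞ → Set} {pw ℓ α w p} →
                      AllEntries P pw → P ℓ α w p → AllEntries P (updatePW pw ℓ α (just (w , p)))
updatePW-AllEntries {pw = pw} {ℓ} {α} {w} {p} all new {ℓ′} {α′} eq
  with updatePW-cases pw ℓ α (just (w , p)) ℓ′ α′
... | inj₁ (refl , refl , upd) with trans (sym upd) eq
...   | refl = new
updatePW-AllEntries all new eq | inj₂ upd = all (trans (sym upd) eq)

Retains : ∀ {m k} → PW m k → PW m k → Set
Retains pw pw′ = ∀ {ℓ α w p} → pw ℓ α ≡ just (w , p) → ∃[ w′ ] ∃[ p′ ] (pw′ ℓ α ≡ just (w′ , p′) × w′ ≤ w)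

Retains-trans : ∀ {m k} {pw pw′ pw″ : PW m k} → Retains pw pw′ → Retains pw′ pw″ → Retains pw pw″
Retains-trans r r′ eq with r eq
... | _ , _ , eq′ , w′≤w with r′ eq′
...   | w″ , p″ , eq″ , w″≤w′ = w″ , p″ , eq″ , ≤-trans w″≤w′ w′≤w

record Extends {m k} (pw pw′ : PW m k) : Set where
  field
    lowers-start : ∀ {ℓ α w p} → pw ℓ α ≡ just (w , p) → ∃[ w′ ] (pw′ ℓ α ≡ just (w′ , p) × w′ ≤ w)
    no-new-passed : ∀ {ℓ α w q} → pw′ ℓ α ≡ just (w , fin q) → ∃[ w₀ ] (pw ℓ α ≡ just (w₀ , fin q))
open Extends

Extends⇒Retains : ∀ {m k} {pw pw′ : PW m k} → Extends pw pw′ → Retains pw pw′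
Extends⇒Retains ext eq with lowers-start ext eq
... | w′ , eq′ , w′≤w = w′ , _ , eq′ , w′≤w

Extends-refl : ∀ {m k} {pw : PW m k} → Extends pw pw
Extends-refl = record { lowers-start = λ eq → _ , eq , ≤-refl ; no-new-passed = λ eq → _ , eq }

Extends-trans : ∀ {m k} {pw pw′ pw″ : PW m k} → Extends pw pw′ → Extends pw′ pw″ → Extends pw pw″
Extends-trans ext ext′ = record
  { lowers-start = λ eq → let (_ , eq′ , w′≤w) = lowers-start ext eq
                              (w″ , eq″ , w″≤w′) = lowers-start ext′ eq′
                          in w″ , eq″ , ≤-trans w″≤w′ w′≤w
  ; no-new-passed = λ eq → no-new-passed ext (proj₂ (no-new-passed ext′ eq)) }

updatePW-insert-extends : ∀ {m k} {pw : PW m k} {ℓ α w} → pw ℓ α ≡ nothing →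
                          Extends pw (updatePW pw ℓ α (just (w , ∞)))
updatePW-insert-extends {pw = pw} {ℓ} {α} {w} fresh = record { lowers-start = lowers ; no-new-passed = no-new }
  where
    lowers : ∀ {ℓ′ α′ w′ p′} → pw ℓ′ α′ ≡ just (w′ , p′) →
             ∃[ w″ ] (updatePW pw ℓ α (just (w , ∞)) ℓ′ α′ ≡ just (w″ , p′) × w″ ≤ w′)
    lowers {ℓ′} {α′} eq with updatePW-cases pw ℓ α (just (w , ∞)) ℓ′ α′
    ... | inj₁ (refl , refl , _) = contradiction (trans (sym fresh) eq) λ ()
    ... | inj₂ upd = _ , trans upd eq , ≤-refl

    no-new : ∀ {ℓ′ α′ w′ q} → updatePW pw ℓ α (just (w , ∞)) ℓ′ α′ ≡ just (w′ , fin q) →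
             ∃[ w₀ ] (pw ℓ′ α′ ≡ just (w₀ , fin q))
    no-new {ℓ′} {α′} eq with updatePW-cases pw ℓ α (just (w , ∞)) ℓ′ α′
    ... | inj₁ (refl , refl , upd) = contradiction (trans (sym upd) eq) λ ()
    ... | inj₂ upd = _ , trans (sym upd) eq

updatePW-lower-extends : ∀ {m k} {pw : PW m k} {ℓ α w w₀ p} → pw ℓ α ≡ just (w₀ , p) → w ≤ w₀ →
                         Extends pw (updatePW pw ℓ α (just (w , p)))
updatePW-lower-extends {pw = pw} {ℓ} {α} {w} {w₀} {p} old w≤w₀ =
  record { lowers-start = lowers ; no-new-passed = no-new }
  where
    lowers : ∀ {ℓ′ α′ w′ p′} → pw ℓ′ α′ ≡ just (w′ , p′) →
             ∃[ w″ ] (updatePW pw ℓ α (just (w , p)) ℓ′ α′ ≡ just (w″ , p′) × w″ ≤ w′)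
    lowers {ℓ′} {α′} eq with updatePW-cases pw ℓ α (just (w , p)) ℓ′ α′
    ... | inj₁ (refl , refl , upd) with trans (sym old) eq
    ...   | refl = w , upd , w≤w₀
    lowers eq | inj₂ upd = _ , trans upd eq , ≤-refl

    no-new : ∀ {ℓ′ α′ w′ q} → updatePW pw ℓ α (just (w , p)) ℓ′ α′ ≡ just (w′ , fin q) →
             ∃[ w₀ ] (pw ℓ′ α′ ≡ just (w₀ , fin q))
    no-new {ℓ′} {α′} eq with updatePW-cases pw ℓ α (just (w , p)) ℓ′ α′
    ... | inj₁ (refl , refl , upd) with trans (sym upd) eq
    ...   | refl = w₀ , old
    no-new eq | inj₂ upd = _ , trans (sym upd) eq

module Correctness {m k : ℕ} (A : TA m k) (ℓg : Fin m) where

  open Algorithm A ℓg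
  open Capping M

  edge-small : ∀ {e} → e ∈ edges A → SmallGuard (guard e)
  edge-small = MC-small A

  Run : Fin m → Valuation k → Set
  Run ℓ v = Star (DSStep A) (ℓ₀ A , zeroVal) (ℓ , v)

  CapReachable : Fin m → Valuation k → Set
  CapReachable ℓ u = ∃[ v ] (Run ℓ v × capV v ≡ u)

  capReachable-delay : ∀ {ℓ u} → CapReachable ℓ u → ∀ d → CapReachable ℓ (u ⊕[ M ] d)
  capReachable-delay (v , run , refl) d = delayBy v d , run ◅◅ (delay d ◅ ε) , capV-delay v d

  capReachable-act : ∀ {e u} → e ∈ edges A → CapReachable (src e) u → u ⊨ guard e →
                     CapReachable (tgt e) (resetVal u (reset e))
  capReachable-act {e} e∈A (v , run , refl) sat =
      resetVal v (reset e)
    , run ◅◅ (act e∈A (Guarded.⊨-capV⁻ {g = guard e} (edge-small e∈A) {v} sat) ◅ ε)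
    , capV-reset v (reset e)

  capReachable⇒reachable : ∀ {u} → CapReachable ℓg u → Reachable A ℓg
  capReachable⇒reachable (v , run , _) = v , run

  record ValidDart (ℓ : Fin m) (α : Valuation k) (w : ℕ) : Set where
    field
      anchor-bounded : Bounded α
      start≤M : w ≤ M
      sound : ∀ d → w ≤ d → CapReachable ℓ (α ⊕[ M ] d)
  open ValidDart

  ValidDart-⊓ : ∀ {ℓ α w w₀} → ValidDart ℓ α w → ValidDart ℓ α w₀ → ValidDart ℓ α (w ⊓ w₀)
  ValidDart-⊓ {w = w} {w₀} valid valid₀ = record
    { anchor-bounded = anchor-bounded valid
    ; start≤M = ≤-trans (m⊓n≤m w w₀) (start≤M valid)
    ; sound = λ d w⊓w₀≤d →
        [ (λ eq → sound valid d (subst (_≤ d) eq w⊓w₀≤d))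
        , (λ eq → sound valid₀ d (subst (_≤ d) eq w⊓w₀≤d)) ]′ (⊓-sel w w₀)
    }

  PassBound : ℕ∞ → Set
  PassBound (fin q) = q ≤ M
  PassBound ∞ = ⊤

  record ValidEntry (ℓ : Fin m) (α : Valuation k) (w : ℕ) (p : ℕ∞) : Set where
    field
      dart : ValidDart ℓ α w
      pass-bound : PassBound p
      not-goal : ¬ ℓ ≡ ℓg
  open ValidEntry

  WellFormed : PW m k → Set
  WellFormed = AllEntries ValidEntry

  record Covered (pw : PW m k) (ℓ : Fin m) (u : Valuation k) : Set where
    constructor covered
    field
      anchor : Valuation k
      elapsed : ℕ
      start : ℕ
      pass : ℕ∞
      entry : pw ℓ anchor ≡ just (start , pass)
      start≤elapsed : start ≤ elapsed
      value : anchor ⊕[ M ] elapsed ≡ u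

  Covered-retains : ∀ {pw pw′ ℓ u} → Retains pw pw′ → Covered pw ℓ u → Covered pw′ ℓ u
  Covered-retains retains (covered α d w p entry w≤d val) with retains entry
  ... | w′ , p′ , entry′ , w′≤w = covered α d w′ p′ entry′ (≤-trans w′≤w w≤d) val

  DartCovered : Fin m → Valuation k → ℕ → PW m k → Set
  DartCovered ℓ α w pw = ∀ d → w ≤ d → Covered pw ℓ (α ⊕[ M ] d)

  Post : PW m k → (PW m k → Set) → Outcome m k → Set
  Post pw T hit = Reachable A ℓg
  Post pw T (cont pw′) = WellFormed pw′ × Extends pw pw′ × T pw′

  Post-map : ∀ {pw} {T U : PW m k → Set} o → (∀ {pw′} → T pw′ → U pw′) → Post pw T o → Post pw U o
  Post-map hit _ reached = reached
  Post-map (cont pw′) f (wf , ext , t) = wf , ext , f t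

  addToPW-spec : ∀ {pw ℓ α w} → WellFormed pw → ValidDart ℓ α w →
                 Post pw (DartCovered ℓ α w) (addToPW pw ℓ α w ∞)
  addToPW-spec {pw} {ℓ} {α} {w} wf valid with ℓ Fin.≟ ℓg
  ... | yes refl = capReachable⇒reachable (sound valid w ≤-refl)
  ... | no ℓ≢ℓg with pw ℓ α in old
  ... | nothing =
      updatePW-AllEntries {pw = pw} {ℓ} {α} {w} {∞} wf (record { dart = valid ; pass-bound = tt ; not-goal = ℓ≢ℓg })
    , updatePW-insert-extends old
    , λ d w≤d → covered α d w ∞ (updatePW-same pw ℓ α _) w≤d refl
  ... | just (w₀ , p₀) =
      updatePW-AllEntries {pw = pw} {ℓ} {α} {w ⊓ w₀} {p₀} wf (record { dart = ValidDart-⊓ valid (dart (wf old))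
                                     ; pass-bound = pass-bound (wf old) ; not-goal = ℓ≢ℓg })
    , updatePW-lower-extends old (m⊓n≤n w w₀)
    , λ d w≤d → covered α d (w ⊓ w₀) p₀ (updatePW-same pw ℓ α _) (≤-trans (m⊓n≤m w w₀) w≤d) refl

  foldPW-spec : ∀ {X : Set} (f : X → PW m k → Outcome m k) (T : X → PW m k → Set) →
    (∀ {x pw pw′} → Extends pw pw′ → T x pw → T x pw′) →
    ∀ xs → (∀ {x} → x ∈ xs → ∀ {pw} → WellFormed pw → Post pw (T x) (f x pw)) →
    ∀ {pw} → WellFormed pw → Post pw (λ pw′ → ∀ {x} → x ∈ xs → T x pw′) (foldPW xs f pw)
  foldPW-spec f T T-mono [] _ wf = wf , Extends-refl , λ ()
  foldPW-spec f T T-mono (x ∷ xs) spec {pw} wf with f x pw | spec (here refl) wf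
  ... | hit | reached = reached
  ... | cont pw₁ | wf₁ , ext₁ , t₁
    with foldPW xs f pw₁ | foldPW-spec f T T-mono xs (λ x∈xs → spec (there x∈xs)) wf₁
  ...   | hit | reached = reached
  ...   | cont pw₂ | wf₂ , ext₂ , ts =
    wf₂ , Extends-trans ext₁ ext₂ , λ { (here refl) → T-mono ext₂ t₁ ; (there y∈xs) → ts y∈xs }

  EdgeCovered : Valuation k → ℕ → ℕ∞ → Edge m k → PW m k → Set
  EdgeCovered α w p e pw = ∀ d → w ≤ d → fin d <∞ p → (α ⊕[ M ] d) ⊨ guard e →
                           Covered pw (tgt e) (resetVal (α ⊕[ M ] d) (reset e))

  EdgeCovered-mono : ∀ {α w p e pw pw′} → Extends pw pw′ → EdgeCovered α w p e pw → EdgeCovered α w p e pw′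
  EdgeCovered-mono ext covers d w≤d d<p sat = Covered-retains (Extends⇒Retains ext) (covers d w≤d d<p sat)

  module HandleEdge {e : Edge m k} (e∈A : e ∈ edges A) {α : Valuation k} {w : ℕ} (p : ℕ∞)
                    (valid : ValidDart (src e) α w) where

    open Guarded {g = guard e} (edge-small e∈A)

    s : ℕ
    s = startOf α w (guard e)

    start≤ : ∀ {d} → w ≤ d → (α ⊕[ M ] d) ⊨ guard e → s ≤ d
    start≤ {d} = ⊨⇒startOf≤ α w d

    fire : ∀ {n} → s ≤ n → n ≤ᵇℤ∞ endOf α (guard e) ≡ true →
           CapReachable (tgt e) (resetVal (α ⊕[ M ] n) (reset e))
    fire {n} s≤n n≤end =
      capReachable-act e∈A (sound valid n (≤-trans (w≤startOf α w (guard e)) s≤n)) (window⇒⊨ α w n s≤n n≤end)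

    late : fin s <ᵇ∞ p ≡ false → ∀ pw → EdgeCovered α w p e pw
    late s≮p pw d w≤d d<p sat =
      contradiction (trans (sym (<∞⇒<ᵇ∞ (≤-<∞-trans (start≤ w≤d sat) d<p))) s≮p) λ ()

    expired : s ≤ᵇℤ∞ endOf α (guard e) ≡ false → ∀ pw → EdgeCovered α w p e pw
    expired s≰end pw d w≤d d<p sat =
      contradiction (trans (sym (⊨⇒≤ᵇendOf α s d (start≤ w≤d sat) sat)) s≰end) λ ()

    no-reset-spec : isEmptySubset (reset e) ≡ true → s ≤ᵇℤ∞ endOf α (guard e) ≡ true → ∀ {pw} → WellFormed pw →
                    Post pw (EdgeCovered α w p e) (addToPW pw (tgt e) (rebase α s) s ∞)
    no-reset-spec R∅ s≤end {pw} wf = Post-map (addToPW pw (tgt e) (rebase α s) s ∞) covers (addToPW-spec wf rebased)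
      where
        unreset : ∀ n → resetVal (α ⊕[ M ] n) (reset e) ≡ α ⊕[ M ] n
        unreset n = resetVal-∅ _ (reset e) R∅

        delayed : ∀ {d} → s ≤ d → resetVal (α ⊕[ M ] s) (reset e) ⊕[ M ] (d ∸ s) ≡ rebase α s ⊕[ M ] d
        delayed {d} s≤d = begin
          resetVal (α ⊕[ M ] s) (reset e) ⊕[ M ] (d ∸ s)   ≡⟨ cong (_⊕[ M ] (d ∸ s)) (unreset s) ⟩
          (α ⊕[ M ] s) ⊕[ M ] (d ∸ s)                      ≡⟨ ⊕-+ α s (d ∸ s) ⟩
          α ⊕[ M ] (s + (d ∸ s))                           ≡⟨ cong (α ⊕[ M ]_) (m+[n∸m]≡n s≤d) ⟩
          α ⊕[ M ] d                                       ≡⟨ rebase-⊕ α s≤d ⟨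
          rebase α s ⊕[ M ] d                              ∎
          where open ≡-Reasoning

        rebased : ValidDart (tgt e) (rebase α s) s
        rebased = record
          { anchor-bounded = rebase-bounded α s
          ; start≤M = startOf-≤ α w (start≤M valid)
          ; sound = λ d s≤d → subst (CapReachable (tgt e)) (delayed s≤d)
                                    (capReachable-delay (fire ≤-refl s≤end) (d ∸ s))
          }

        covers : ∀ {pw′} → DartCovered (tgt e) (rebase α s) s pw′ → EdgeCovered α w p e pw′
        covers {pw′} dart-covered d w≤d _ sat =
          subst (Covered pw′ (tgt e)) (trans (rebase-⊕ α (start≤ w≤d sat)) (sym (unreset d)))
                (dart-covered d (start≤ w≤d sat))

    before-pass? : (n : ℕ) → Dec ((fin n <ᵇ∞ p) ≡ true)
    before-pass? n = (fin n <ᵇ∞ p) Bool.≟ true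

    before-end? : (n : ℕ) → Dec ((n ≤ᵇℤ∞ endOf α (guard e)) ≡ true)
    before-end? n = (n ≤ᵇℤ∞ endOf α (guard e)) Bool.≟ true

    delays : ℕ → List ℕ
    delays S = List.filter before-end? (List.filter before-pass? (range s S))

    ∈-delays⁻ : ∀ {S n} → n ∈ delays S → s ≤ n × n ≤ᵇℤ∞ endOf α (guard e) ≡ true
    ∈-delays⁻ n∈ with ∈-filter⁻ before-end? n∈
    ... | n∈′ , n≤end = ∈-range⁻ (proj₁ (∈-filter⁻ before-pass? n∈′)) , n≤end

    ∈-delays⁺ : ∀ {S n} → s ≤ n → n ≤ S → fin n <∞ p → n ≤ᵇℤ∞ endOf α (guard e) ≡ true → n ∈ delays S
    ∈-delays⁺ s≤n n≤S n<p n≤end =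
      ∈-filter⁺ before-end? (∈-filter⁺ before-pass? (∈-range⁺ s≤n n≤S) (<∞⇒<ᵇ∞ n<p)) n≤end

    target : ℕ → Valuation k
    target n = resetVal (α ⊕[ M ] n) (reset e)

    target-bounded : ∀ n → Bounded (target n)
    target-bounded n = reset-bounded (α ⊕[ M ] n) (reset e) (⊕-bounded α n)

    addTarget : ℕ → PW m k → Outcome m k
    addTarget n pw = addToPW pw (tgt e) (target n) 0 ∞

    reset-spec : ∀ S → s ≤ S → Saturated α (reset e) S → ∀ {pw} → WellFormed pw →
                 Post pw (EdgeCovered α w p e) (foldPW (delays S) addTarget pw)
    reset-spec S s≤S saturated {pw} wf =
      Post-map (foldPW (delays S) addTarget pw) covers
        (foldPW-spec addTarget (λ n → DartCovered (tgt e) (target n) 0)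
                     (λ ext t d z≤d → Covered-retains (Extends⇒Retains ext) (t d z≤d)) (delays S) add-spec wf)
      where
        add-spec : ∀ {n} → n ∈ delays S → ∀ {pw′} → WellFormed pw′ →
                   Post pw′ (DartCovered (tgt e) (target n) 0) (addTarget n pw′)
        add-spec {n} n∈ wf′ with ∈-delays⁻ n∈
        ... | s≤n , n≤end = addToPW-spec wf′ (record
          { anchor-bounded = target-bounded n
          ; start≤M = z≤n
          ; sound = λ d _ → capReachable-delay (fire s≤n n≤end) d
          })

        covered-at : ∀ {pw′} → (∀ {n} → n ∈ delays S → DartCovered (tgt e) (target n) 0 pw′) →
                     ∀ {n} → n ∈ delays S → Covered pw′ (tgt e) (target n)
        covered-at {pw′} dart-covered {n} n∈ =
          subst (Covered pw′ (tgt e)) (⊕-zero (target-bounded n)) (dart-covered n∈ 0 z≤n)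

        covers : ∀ {pw′} → (∀ {n} → n ∈ delays S → DartCovered (tgt e) (target n) 0 pw′) → EdgeCovered α w p e pw′
        covers {pw′} dart-covered d w≤d d<p sat with d ≤? S
        ... | yes d≤S = covered-at dart-covered
                          (∈-delays⁺ (start≤ w≤d sat) d≤S d<p (⊨⇒≤ᵇendOf α d d ≤-refl sat))
        ... | no d≰S = subst (Covered pw′ (tgt e)) (sym (reset-stable α (reset e) S≤d saturated))
                         (covered-at dart-covered
                            (∈-delays⁺ s≤S ≤-refl (≤-<∞-trans S≤d d<p) (⊨⇒≤ᵇendOf α S d S≤d sat)))
          where
            S≤d : S ≤ d
            S≤d = <⇒≤ (≰⇒> d≰S)

    handleEdge-spec : ∀ {pw} → WellFormed pw → Post pw (EdgeCovered α w p e) (handleEdge α w p e pw)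
    handleEdge-spec {pw} wf with fin s <ᵇ∞ p in s<p | s ≤ᵇℤ∞ endOf α (guard e) in s≤end
    ... | false | _ = wf , Extends-refl , late s<p pw
    ... | true | false = wf , Extends-refl , expired s≤end pw
    ... | true | true with isEmptySubset (reset e) in R∅
    ...   | true = no-reset-spec R∅ s≤end wf
    ...   | false with minFree α (reset e) in min≡
    ...     | fin mn = reset-spec (s ⊔ (suc M ∸ mn)) (m≤m⊔n s _) (saturated-fin α (reset e) min≡ s) wf
    ...     | ∞ = reset-spec s ≤-refl (saturated-∞ α (reset e) min≡ s) wf

  ClosedAt : PW m k → Fin m → Valuation k → ℕ → Set
  ClosedAt pw ℓ α d = ∀ {e} → e ∈ edges A → src e ≡ ℓ → (α ⊕[ M ] d) ⊨ guard e →
                      Covered pw (tgt e) (resetVal (α ⊕[ M ] d) (reset e))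

  Closed : PW m k → Set
  Closed pw = ∀ {ℓ α w q} → pw ℓ α ≡ just (w , fin q) → ∀ d → q ≤ d → ClosedAt pw ℓ α d

  record Invariant (pw : PW m k) : Set where
    field
      wellFormed : WellFormed pw
      initial : Covered pw (ℓ₀ A) zeroVal
      closed : Closed pw

  μ : Maybe (ℕ × ℕ∞) → ℕ
  μ nothing = suc (suc M)
  μ (just (_ , ∞)) = suc M
  μ (just (_ , fin q)) = q

  μ-≤ : ∀ {pw} → WellFormed pw → ∀ ℓ α → μ (pw ℓ α) ≤ suc (suc M)
  μ-≤ {pw} wf ℓ α with pw ℓ α in entry
  ... | nothing = ≤-refl
  ... | just (_ , ∞) = n≤1+n _
  ... | just (_ , fin q) = ≤-trans (pass-bound (wf entry)) (≤-trans (n≤1+n M) (n≤1+n _))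

  μ-extends : ∀ {pw pw′} → Extends pw pw′ → WellFormed pw′ → ∀ ℓ α → μ (pw′ ℓ α) ≤ μ (pw ℓ α)
  μ-extends {pw} {pw′} ext wf′ ℓ α with pw ℓ α in old
  ... | nothing = μ-≤ wf′ ℓ α
  ... | just (w , p) with lowers-start ext old
  ...   | _ , new , _ rewrite new = same-pass p
    where
      same-pass : ∀ p {w w′} → μ (just (w′ , p)) ≤ μ (just (w , p))
      same-pass (fin q) = ≤-refl
      same-pass ∞ = ≤-refl

  -- Φ only sums over bounded anchors, which are the only ones a well-formed list can hold.
  boundedDarts : List (Fin m × Valuation k)
  boundedDarts = List.cartesianProduct (allFin m) (vecsBelow (suc (suc M)) k)

  Φ : PW m k → ℕ
  Φ pw = sum (List.map (uncurry λ ℓ α → μ (pw ℓ α)) boundedDarts)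

  Φ-mono : ∀ {pw pw′} → (∀ ℓ α → μ (pw′ ℓ α) ≤ μ (pw ℓ α)) → Φ pw′ ≤ Φ pw
  Φ-mono μ≤ = sum-map-mono (uncurry μ≤) boundedDarts

  Φ-mono-< : ∀ {pw pw′} → (∀ ℓ α → μ (pw′ ℓ α) ≤ μ (pw ℓ α)) →
             ∀ ℓ α → Bounded α → μ (pw′ ℓ α) < μ (pw ℓ α) → Φ pw′ < Φ pw
  Φ-mono-< μ≤ ℓ α α-bounded μ< =
    sum-map-mono-< (uncurry μ≤) boundedDarts
      (∈-cartesianProduct⁺ (∈-allFin ℓ) (∈-vecsBelow α (s≤s ∘ α-bounded))) μ<

  edgesFrom : Fin m → List (Edge m k)
  edgesFrom ℓ = List.filter (λ e → src e Fin.≟ ℓ) (edges A)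

  Progress : PW m k → Outcome m k → Set
  Progress pw hit = Reachable A ℓg
  Progress pw (cont pw′) = Invariant pw′ × Φ pw′ < Φ pw

  module Iteration {pw ℓ α w p} (inv : Invariant pw) (entry : pw ℓ α ≡ just (w , p)) (w<p : fin w <∞ p) where

    open Invariant inv

    valid : ValidEntry ℓ α w p
    valid = wellFormed entry

    passed : PW m k
    passed = updatePW pw ℓ α (just (w , fin w))

    passed-wf : WellFormed passed
    passed-wf = updatePW-AllEntries {pw = pw} {ℓ} {α} {w} {fin w} wellFormed
      (record { dart = dart valid ; pass-bound = start≤M (dart valid) ; not-goal = not-goal valid })

    retains-passed : Retains pw passed
    retains-passed {ℓ′} {α′} eq with updatePW-cases pw ℓ α (just (w , fin w)) ℓ′ α′
    ... | inj₁ (refl , refl , upd) with trans (sym entry) eq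
    ...   | refl = w , fin w , upd , ≤-refl
    retains-passed eq | inj₂ upd = _ , _ , trans upd eq , ≤-refl

    retains-after : ∀ {pw′} → Extends passed pw′ → Retains pw pw′
    retains-after {pw′} ext = Retains-trans {pw = pw} {passed} {pw′} retains-passed (Extends⇒Retains ext)

    μ-passed-< : μ (passed ℓ α) < μ (pw ℓ α)
    μ-passed-< rewrite updatePW-same pw ℓ α (just (w , fin w)) | entry = below-pass p w<p
      where
        below-pass : ∀ p → fin w <∞ p → w < μ (just (w , p))
        below-pass (fin q) (fin<fin w<q) = w<q
        below-pass ∞ fin<∞ = s≤s (start≤M (dart valid))

    μ-passed-≤ : ∀ ℓ′ α′ → μ (passed ℓ′ α′) ≤ μ (pw ℓ′ α′)
    μ-passed-≤ ℓ′ α′ with updatePW-cases pw ℓ α (just (w , fin w)) ℓ′ α′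
    ... | inj₁ (refl , refl , _) = <⇒≤ μ-passed-<
    ... | inj₂ upd = ≤-reflexive (cong μ upd)

    EdgesCovered : PW m k → Set
    EdgesCovered pw′ = ∀ {e} → e ∈ edgesFrom ℓ → EdgeCovered α w p e pw′

    edges-spec : Post passed EdgesCovered (iteration pw ℓ α w p)
    edges-spec = foldPW-spec (handleEdge α w p) (EdgeCovered α w p) (λ {e} → EdgeCovered-mono {α} {w} {p} {e})
                             (edgesFrom ℓ) handle passed-wf
      where
        handle : ∀ {e} → e ∈ edgesFrom ℓ → ∀ {pw′} → WellFormed pw′ →
                 Post pw′ (EdgeCovered α w p e) (handleEdge α w p e pw′)
        handle e∈ wf′ with ∈-filter⁻ (λ e → src e Fin.≟ ℓ) e∈
        ... | e∈A , refl = HandleEdge.handleEdge-spec e∈A p (dart valid) wf′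

    -- Delays of the picked dart below p are closed by the edges just handled, later ones by the old invariant.
    closed-after : ∀ {pw′} → Extends passed pw′ → EdgesCovered pw′ → Closed pw′
    closed-after {pw′} ext covers {ℓ′} {α′} entry′ d q≤d {e} e∈A src≡ sat
      with no-new-passed ext entry′
    ... | _ , entry₁ with updatePW-cases pw ℓ α (just (w , fin w)) ℓ′ α′
    ...   | inj₂ upd = Covered-retains (retains-after ext) (closed (trans (sym upd) entry₁) d q≤d e∈A src≡ sat)
    ...   | inj₁ (refl , refl , upd) with trans (sym upd) entry₁ | d <∞? p
    ...     | refl | yes d<p = covers (∈-filter⁺ (λ e → src e Fin.≟ ℓ) e∈A src≡) d q≤d d<p sat
    ...     | refl | no d≮p with ≮∞⇒≡fin p d≮p
    ...       | p₀ , refl , p₀≤d = Covered-retains (retains-after ext) (closed entry d p₀≤d e∈A src≡ sat)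

    iteration-spec : Progress pw (iteration pw ℓ α w p)
    iteration-spec with iteration pw ℓ α w p | edges-spec
    ... | hit | reached = reached
    ... | cont pw′ | wf′ , ext , covers =
        record { wellFormed = wf′
               ; initial = Covered-retains (retains-after ext) initial
               ; closed = closed-after ext covers }
      , ≤-<-trans (Φ-mono {passed} {pw′} (μ-extends ext wf′))
                  (Φ-mono-< {pw} {passed} μ-passed-≤ ℓ α (anchor-bounded (dart valid)) μ-passed-<)

  module Exhausted {pw} (inv : Invariant pw) (done : ∀ ℓ α w p → pw ℓ α ≡ just (w , p) → ¬ fin w <∞ p) where

    open Invariant inv

    CoveredState : State m k → Set
    CoveredState (ℓ , v) = Covered pw ℓ (capV v)

    covered-step : ∀ {s t} → DSStep A s t → CoveredState s → CoveredState t
    covered-step (act {e} {v} e∈A sat) (covered α d w p entry w≤d val) with ≮∞⇒≡fin p (done _ α w p entry)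
    ... | q , refl , q≤w =
      subst (Covered pw (tgt e)) (trans (cong (λ u → resetVal u (reset e)) val) (sym (capV-reset v (reset e))))
            (closed entry d (≤-trans q≤w w≤d) e∈A refl
                    (subst (_⊨ guard e) (sym val) (Guarded.⊨-capV⁺ {g = guard e} (edge-small e∈A) {v} sat)))
    covered-step (delay {v = v} d′) (covered α d w p entry w≤d val) =
      covered α (d + d′) w p entry (≤-trans w≤d (m≤m+n d d′)) (begin
        α ⊕[ M ] (d + d′)           ≡⟨ ⊕-+ α d d′ ⟨
        (α ⊕[ M ] d) ⊕[ M ] d′      ≡⟨ cong (_⊕[ M ] d′) val ⟩
        capV v ⊕[ M ] d′            ≡⟨ capV-delay v d′ ⟨
        capV (delayBy v d′)         ∎)
      where open ≡-Reasoning

    covered-run : ∀ {s t} → Star (DSStep A) s t → CoveredState s → CoveredState t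
    covered-run ε c = c
    covered-run (step ◅ run) c = covered-run run (covered-step step c)

    unreachable : ¬ Reachable A ℓg
    unreachable (v , run) = not-goal (wellFormed (Covered.entry reached-goal)) refl
      where
        reached-goal : Covered pw ℓg (capV v)
        reached-goal = covered-run run (subst (Covered pw (ℓ₀ A)) (sym capV-zero) initial)

  Consistent : Config → Set
  Consistent (running pw) = Invariant pw
  Consistent (returned true) = Reachable A ℓg
  Consistent (returned false) = ¬ Reachable A ℓg

  initial-dart : ValidDart (ℓ₀ A) zeroVal 0
  initial-dart = record
    { anchor-bounded = zero-bounded
    ; start≤M = z≤n
    ; sound = λ d _ → subst (CapReachable (ℓ₀ A)) (cong (_⊕[ M ] d) capV-zero) (capReachable-delay (zeroVal , ε , refl) d)
    }

  initial-consistent : Consistent initConfig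
  initial-consistent with addToPW emptyPW (ℓ₀ A) zeroVal 0 ∞ | addToPW-spec {emptyPW} (λ ()) initial-dart
  ... | hit | reached = reached
  ... | cont pw | wf , ext , dart-covered = record
    { wellFormed = wf
    ; initial = subst (Covered pw (ℓ₀ A)) (⊕-zero zero-bounded) (dart-covered 0 z≤n)
    ; closed = λ entry → contradiction (proj₂ (no-new-passed ext entry)) λ ()
    }

  step-consistent : ∀ {c c′} → AlgStep c c′ → Consistent c → Consistent c′
  step-consistent (pick pw ℓ α w p entry w<p) inv with iteration pw ℓ α w p | Iteration.iteration-spec inv entry w<p
  ... | hit | reached = reached
  ... | cont pw′ | inv′ , _ = inv′
  step-consistent (finish pw done) inv = Exhausted.unreachable inv done

  run-consistent : ∀ {c c′} → Star AlgStep c c′ → Consistent c → Consistent c′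
  run-consistent ε c-consistent = c-consistent
  run-consistent (step ◅ run) c-consistent = run-consistent run (step-consistent step c-consistent)

  Accessible : Config → Set
  Accessible = Acc (λ c′ c → AlgStep c c′)

  returned-accessible : ∀ b → Accessible (returned b)
  returned-accessible b = acc λ ()

  running-accessible : ∀ n {pw} → Φ pw < n → Invariant pw → Accessible (running pw)
  running-accessible (suc n) {pw} Φ<n inv = acc next
    where
      continue : ∀ o → Progress pw o → Accessible (toConfig o)
      continue hit _ = returned-accessible true
      continue (cont pw′) (inv′ , Φ′<Φ) = running-accessible n (≤-trans Φ′<Φ (ℕ.s≤s⁻¹ Φ<n)) inv′

      next : ∀ {c′} → AlgStep (running pw) c′ → Accessible c′
      next (pick .pw ℓ α w p entry w<p) = continue (iteration pw ℓ α w p) (Iteration.iteration-spec inv entry w<p)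
      next (finish .pw _) = returned-accessible false

  terminates : Accessible initConfig
  terminates = consistent-accessible initConfig initial-consistent
    where
      consistent-accessible : ∀ c → Consistent c → Accessible c
      consistent-accessible (running pw) inv = running-accessible (suc (Φ pw)) ≤-refl inv
      consistent-accessible (returned b) _ = returned-accessible b

  stuck⇒returned : ∀ c → Star AlgStep initConfig c → (∀ c′ → ¬ AlgStep c c′) → ∃[ b ] (c ≡ returned b)
  stuck⇒returned (running pw) _ stuck =
    ⊥-elim (stuck _ (finish pw λ ℓ α w p entry w<p → stuck _ (pick pw ℓ α w p entry w<p)))
  stuck⇒returned (returned b) _ _ = b , refl

  returned-correct : ∀ b → Star AlgStep initConfig (returned b) → ((b ≡ true) ⇔ Reachable A ℓg)
  returned-correct true run = mk⇔ (λ _ → run-consistent run initial-consistent) (λ _ → refl)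
  returned-correct false run = mk⇔ (λ ()) (λ reachable → contradiction reachable (run-consistent run initial-consistent))

theorem3 : ∀ {m k} (A : TA m k) (ℓg : Fin m) →
    let open Algorithm A ℓg in
      Acc (λ c' c → AlgStep c c') initConfig
      × (∀ c → Star AlgStep initConfig c → (∀ c' → ¬ AlgStep c c') → ∃[ b ] (c ≡ returned b))
      × (∀ b → Star AlgStep initConfig (returned b) → ((b ≡ true) ⇔ Reachable A ℓg))
theorem3 A ℓg = terminates , stuck⇒returned , returned-correct
  where open Correctness A ℓg
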